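{- Let $m\ge0$ be even and let $Z(m)$ be the sum of the distinct pivot values (each value counted once) of the self twin parsimonious games with $m+4$ players whose free type representation has an odd number of components. Then $Z(m)=2+\left(\frac m2+1\right)^2$.
   Context: Parsimonious (P) games: constant-sum homogeneous weighted majority games on $n$ players, without dummies and without dictator, having exactly $n$ minimal winning coalitions (homogeneous: weights $\mathbf w$, quota $q$, $S$ winning iff $\sum_{i\in S}w_i\ge q$, with equality for every minimal winning $S$). Each has a unique minimal homogeneous representation with integer weights $1=w_1\le\dots\le w_n$. Binary representation: $\mathbf b\in\{0,1\}^n$, $b_1=1$, $b_i=1$ iff $w_i>w_{i-1}$. Known: $b_1=1,b_2=0,b_{n-1}=0,b_n=1$ always, and $(b_3,\dots,b_{n-2})$ determines the game, every vector in $\{0,1\}^{n-4}$ arising. The number of types $h$ is the number of distinct weights; the type representation is $(x_1,\dots,x_h)$, $x_t$ the number of players with the $t$-th smallest distinct weight; the free type representation is $(x_1,\dots,x_{h-1})$. A P game is self twin if $b_i=b_{n+1-i}$ for $i=3,\dots,n-2$. When $h-1$ is odd, the middle component $x_{h/2}$ is called the pivot. -}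

module Defs where

open import Data.Bool using (Bool; true; false)
open import Data.Bool.Properties using () renaming (_≟_ to _≟ᵇ_)
open import Data.Nat using (ℕ; zero; suc; _+_; _∸_; _/_; _%_)
open import Data.Nat.Properties using (_≟_)
open import Data.List using (List; []; _∷_; _++_; map; concat; length; reverse; filter; mapMaybe; deduplicate)
open import Data.Nat.ListAction using (sum)
open import Data.List.Properties using (≡-dec)
open import Data.Maybe using (Maybe; just; nothing)
open import Data.Product using (_×_; _,_; proj₂)
open import Relation.Binary.PropositionalEquality using (_≡_)
import Relation.Nullary

-- All 0/1 lists of length m (free part (b_3,…,b_{n-2}) of the binary
-- representation of a P game with n = m+4 players).
allBoolLists : ℕ → List (List Bool)
allBoolLists zero = [] ∷ []
allBoolLists (suc m) =
  concat (map (λ c → (false ∷ c) ∷ (true ∷ c) ∷ []) (allBoolLists m))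

binRep : List Bool → List Bool
binRep c = true ∷ false ∷ c ++ (false ∷ true ∷ [])

-- Run lengths: returns (number of leading 0s, type sizes of the groups
-- each started by a 1).  A new weight (type) starts exactly where b_i = 1.
typesAux : List Bool → ℕ × List ℕ
typesAux [] = 0 , []
typesAux (false ∷ bs) with typesAux bs
... | k , g = suc k , g
typesAux (true ∷ bs) with typesAux bs
... | k , g = 0 , suc k ∷ g

typeRep : List Bool → List ℕ
typeRep b = proj₂ (typesAux b)

dropLast : List ℕ → List ℕ
dropLast [] = []
dropLast (x ∷ []) = []
dropLast (x ∷ y ∷ xs) = x ∷ dropLast (y ∷ xs)

freeTypeRep : List Bool → List ℕ
freeTypeRep b = dropLast (typeRep b)

-- 1-based indexing.
nth1 : List ℕ → ℕ → Maybe ℕ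
nth1 [] _ = nothing
nth1 (x ∷ xs) zero = nothing
nth1 (x ∷ xs) (suc zero) = just x
nth1 (x ∷ xs) (suc (suc i)) = nth1 xs (suc i)

pivot : List Bool → Maybe ℕ
pivot b with length (freeTypeRep b) % 2
... | 1 = nth1 (typeRep b) (length (typeRep b) / 2)
... | _ = nothing

-- Self twin: b_i = b_{n+1-i} for i = 3,…,n-2, i.e. the free part is a palindrome.
SelfTwin : List Bool → Set
SelfTwin c = reverse c ≡ c

selfTwin? : (c : List Bool) → Relation.Nullary.Dec (SelfTwin c)
selfTwin? c = ≡-dec _≟ᵇ_ (reverse c) c

selfTwinGames : ℕ → List (List Bool)
selfTwinGames m = filter selfTwin? (allBoolLists m)

Z : ℕ → ℕ
Z m = sum (deduplicate _≟_ (mapMaybe (λ c → pivot (binRep c)) (selfTwinGames m)))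

{-# OPTIONS --safe #-}
-- The binary representation of a self twin game with m = 2k is A ++ reverse A, where A = 1 0 d
-- and |d| = k.  If s is the number of 0s after the last 1 of A, the type representation is
-- X ++ (2s+1) ∷ Y with |Y| = |X| + 1, so the free type representation has odd length and the
-- pivot is 2s+1.  The last 1 of A lies in d (s = 0, …, k-1) or is the leading 1 (d = 0…0,
-- s = k+1), so the distinct pivots are 1, 3, …, 2k-1 and 2k+3.
module Submission where

open import Defs
open import Data.Bool using (Bool; true; false)
open import Data.Nat using (ℕ; zero; suc; _+_; _*_; _^_; _∸_; _⊓_; _<_; _%_; _/_; s≤s; _≟_)
open import Data.Nat.Properties
  using ( +-suc; +-comm; +-identityʳ; +-mono-<; >⇒≢; m<n⇒m<1+n; n<1+n; m≤n+m; m≤m+n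
        ; m≤n⇒m⊓n≡m; m+n∸m≡n; m∸n+n≡m; suc-injective; module ≤-Reasoning)
open import Data.Nat.DivMod using ([m+kn]%n≡m%n; m*n/n≡m)
open import Data.Nat.ListAction using (sum)
open import Data.Nat.ListAction.Properties using (sum-↭)
open import Data.Nat.Solver using (module +-*-Solver)
open import Data.List
  using ( List; []; _∷_; _∷ʳ_; _++_; map; length; reverse; filter; mapMaybe; deduplicate
        ; replicate; applyDownFrom; take; drop)
open import Data.List.Properties
  using ( ∷-injectiveʳ; ++-assoc; unfold-reverse; length-++; length-replicate; length-reverse
        ; length-take; length-drop; reverse-++; reverse-involutive; take++drop≡id)
open import Data.List.Relation.Unary.Any using (here; there)
import Data.List.Relation.Unary.Any as Any
import Data.List.Relation.Unary.Any.Properties as Anyₚ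
import Data.List.Relation.Unary.All as All
open import Data.List.Relation.Unary.Unique.Propositional using (Unique; _∷_)
open import Data.List.Relation.Unary.Unique.Propositional.Properties using (applyDownFrom⁺₁)
open import Data.List.Relation.Unary.Unique.DecPropositional.Properties using (deduplicate-!)
open import Data.List.Membership.Propositional using (_∈_)
open import Data.List.Membership.Propositional.Properties
  using ( ∈-map⁺; ∈-map⁻; ∈-concat⁺′; ∈-concat⁻′; ∈-filter⁺; ∈-filter⁻
        ; ∈-applyDownFrom⁺; ∈-applyDownFrom⁻; deduplicate-∈⇔)
open import Data.List.Membership.Propositional.Properties.WithK using (unique∧set⇒bag)
open import Data.List.Relation.Binary.BagAndSetEquality using (∼bag⇒↭)
open import Data.List.Relation.Binary.Permutation.Propositional.Properties
  using (↭-length; ↭-reverse; filter-↭)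
open import Data.Maybe using (Maybe; just; nothing)
import Data.Maybe.Relation.Unary.Any as MaybeAny
open import Data.Maybe.Properties using (just-injective)
open import Data.Product using (_×_; _,_; proj₁; proj₂; ∃-syntax; map₁)
open import Function.Base using (_∘_)
open import Function.Bundles using (_⇔_; mk⇔)
import Function.Properties.Equivalence as ⇔
open import Relation.Binary.PropositionalEquality
  using (_≡_; _≢_; refl; sym; trans; cong; cong₂; subst; module ≡-Reasoning)
open import Relation.Nullary.Decidable.Core using (T?)

private
  variable
    A B : Set

replicate-++ : ∀ m n (x : A) → replicate m x ++ replicate n x ≡ replicate (m + n) x
replicate-++ zero    n x = refl
replicate-++ (suc m) n x = cong (x ∷_) (replicate-++ m n x)

reverse-replicate : ∀ n (x : A) → reverse (replicate n x) ≡ replicate n x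
reverse-replicate zero    x = refl
reverse-replicate (suc n) x = begin
  reverse (x ∷ replicate n x)   ≡⟨ unfold-reverse x (replicate n x) ⟩
  reverse (replicate n x) ∷ʳ x  ≡⟨ cong (_∷ʳ x) (reverse-replicate n x) ⟩
  replicate n x ++ x ∷ []       ≡⟨ replicate-++ n 1 x ⟩
  replicate (n + 1) x           ≡⟨ cong (λ k → replicate k x) (+-comm n 1) ⟩
  replicate (suc n) x           ∎
  where open ≡-Reasoning

palindrome-halves : ∀ k (c : List A) → length c ≡ k + k → reverse c ≡ c →
                    ∃[ d ] length d ≡ k × c ≡ d ++ reverse d
palindrome-halves k c ∣c∣ c-pal = take k c , ∣take∣ , (begin
  c                              ≡⟨ take++drop≡id k c ⟨
  take k c ++ drop k c           ≡⟨ cong (take k c ++_) drop≡reverse-take ⟨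
  take k c ++ reverse (take k c) ∎)
  where
  open ≡-Reasoning
  cancel-prefix : ∀ (xs ys : List A) {zs ws} → length xs ≡ length ys → xs ++ zs ≡ ys ++ ws → zs ≡ ws
  cancel-prefix []       []       _ eq = eq
  cancel-prefix (x ∷ xs) (y ∷ ys) l eq = cancel-prefix xs ys (suc-injective l) (∷-injectiveʳ eq)
  ∣take∣ : length (take k c) ≡ k
  ∣take∣ = trans (length-take k c) (trans (cong (k ⊓_) ∣c∣) (m≤n⇒m⊓n≡m (m≤m+n k k)))
  same-length : length (reverse (drop k c)) ≡ length (take k c)
  same-length = begin
    length (reverse (drop k c)) ≡⟨ length-reverse (drop k c) ⟩
    length (drop k c)           ≡⟨ length-drop k c ⟩
    length c ∸ k                ≡⟨ cong (_∸ k) ∣c∣ ⟩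
    k + k ∸ k                   ≡⟨ m+n∸m≡n k k ⟩
    k                           ≡⟨ ∣take∣ ⟨
    length (take k c)           ∎
  reversed : reverse (drop k c) ++ reverse (take k c) ≡ take k c ++ drop k c
  reversed = begin
    reverse (drop k c) ++ reverse (take k c) ≡⟨ reverse-++ (take k c) (drop k c) ⟨
    reverse (take k c ++ drop k c)           ≡⟨ cong reverse (take++drop≡id k c) ⟩
    reverse c                                ≡⟨ c-pal ⟩
    c                                        ≡⟨ take++drop≡id k c ⟨
    take k c ++ drop k c                     ∎
  drop≡reverse-take : reverse (take k c) ≡ drop k c
  drop≡reverse-take = cancel-prefix (reverse (drop k c)) (take k c) same-length reversed

mirror-trailing-run : ∀ P (x y : A) s → let B = P ++ x ∷ replicate s y in
  B ++ reverse B ≡ P ++ x ∷ replicate (s + s) y ++ x ∷ reverse P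
mirror-trailing-run P x y s = begin
  (P ++ x ∷ R) ++ reverse (P ++ x ∷ R)       ≡⟨ ++-assoc P (x ∷ R) _ ⟩
  P ++ x ∷ R ++ reverse (P ++ x ∷ R)         ≡⟨ cong (λ z → P ++ x ∷ R ++ z) (reverse-++ P (x ∷ R)) ⟩
  P ++ x ∷ R ++ reverse (x ∷ R) ++ reverse P ≡⟨ cong (λ z → P ++ x ∷ R ++ z ++ reverse P) reverse-x∷R ⟩
  P ++ x ∷ R ++ (R ++ x ∷ []) ++ reverse P   ≡⟨ cong (λ z → P ++ x ∷ R ++ z) (++-assoc R (x ∷ []) (reverse P)) ⟩
  P ++ x ∷ R ++ R ++ x ∷ reverse P           ≡⟨ cong (λ z → P ++ x ∷ z) (++-assoc R R _) ⟨
  P ++ x ∷ (R ++ R) ++ x ∷ reverse P         ≡⟨ cong (λ z → P ++ x ∷ z ++ x ∷ reverse P) (replicate-++ s s y) ⟩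
  P ++ x ∷ replicate (s + s) y ++ x ∷ reverse P ∎
  where
  open ≡-Reasoning
  R = replicate s y
  reverse-x∷R : reverse (x ∷ R) ≡ R ++ x ∷ []
  reverse-x∷R = trans (unfold-reverse x R) (cong (_∷ʳ x) (reverse-replicate s y))

data LastTrue : List Bool → Set where
  all-false : ∀ n → LastTrue (replicate n false)
  ends-with : ∀ P s → LastTrue (P ++ true ∷ replicate s false)

lastTrue : ∀ bs → LastTrue bs
lastTrue []       = all-false 0
lastTrue (b ∷ bs) with lastTrue bs
lastTrue (false ∷ _) | all-false n   = all-false (suc n)
lastTrue (true ∷ _)  | all-false n   = ends-with [] n
lastTrue (b ∷ _)     | ends-with P s = ends-with (b ∷ P) s

∈-mapMaybe⁺ : (f : A → Maybe B) {xs : List A} {x : A} {y : B} →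
              x ∈ xs → f x ≡ just y → y ∈ mapMaybe f xs
∈-mapMaybe⁺ f {xs} {x} {y} x∈xs fx≡y = Anyₚ.mapMaybe⁺ f xs (Anyₚ.map⁺ (Any.map just-at x∈xs))
  where
  just-at : ∀ {x′} → x ≡ x′ → MaybeAny.Any (y ≡_) (f x′)
  just-at refl = subst (MaybeAny.Any (y ≡_)) (sym fx≡y) (MaybeAny.just refl)

∈-mapMaybe⁻ : (f : A → Maybe B) (xs : List A) {y : B} →
              y ∈ mapMaybe f xs → ∃[ x ] x ∈ xs × f x ≡ just y
∈-mapMaybe⁻ f (x ∷ xs) y∈ with f x in fx≡
... | nothing = let x′ , x′∈ , eq = ∈-mapMaybe⁻ f xs y∈ in x′ , there x′∈ , eq
... | just z with y∈
...   | here refl = x , here refl , fx≡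
...   | there y∈′ = let x′ , x′∈ , eq = ∈-mapMaybe⁻ f xs y∈′ in x′ , there x′∈ , eq

sum-deduplicate : {xs ys : List ℕ} → Unique ys → (∀ {x} → x ∈ xs ⇔ x ∈ ys) →
                  sum (deduplicate _≟_ xs) ≡ sum ys
sum-deduplicate {xs} {ys} ys! xs≈ys = sum-↭ (∼bag⇒↭ (unique∧set⇒bag (deduplicate-! _≟_ xs) ys! dedup≈ys))
  where
  dedup≈ys : ∀ {x} → x ∈ deduplicate _≟_ xs ⇔ x ∈ ys
  dedup≈ys = ⇔.trans (⇔.sym (deduplicate-∈⇔ _≟_)) xs≈ys

-- Type representations and pivots

typesAux-++-true : ∀ xs ys →
  typesAux (xs ++ true ∷ ys) ≡ (proj₁ (typesAux xs) , typeRep xs ++ typeRep (true ∷ ys))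
typesAux-++-true []           ys = refl
typesAux-++-true (false ∷ xs) ys = cong (map₁ suc) (typesAux-++-true xs ys)
typesAux-++-true (true ∷ xs)  ys = cong (λ p → 0 , suc (proj₁ p) ∷ proj₂ p) (typesAux-++-true xs ys)

typeRep-++-true : ∀ xs ys → typeRep (xs ++ true ∷ ys) ≡ typeRep xs ++ typeRep (true ∷ ys)
typeRep-++-true xs ys = cong proj₂ (typesAux-++-true xs ys)

typesAux-replicate-false : ∀ n → typesAux (replicate n false) ≡ (n , [])
typesAux-replicate-false zero    = refl
typesAux-replicate-false (suc n) = cong (map₁ suc) (typesAux-replicate-false n)

typeRep-run : ∀ t ys → typeRep (true ∷ replicate t false ++ true ∷ ys) ≡ suc t ∷ typeRep (true ∷ ys)
typeRep-run t ys rewrite typesAux-++-true (replicate t false) ys | typesAux-replicate-false t = refl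

length-typeRep : ∀ bs → length (typeRep bs) ≡ length (filter T? bs)
length-typeRep []           = refl
length-typeRep (false ∷ bs) = length-typeRep bs
length-typeRep (true ∷ bs)  = cong suc (length-typeRep bs)

length-typeRep-reverse : ∀ bs → length (typeRep (reverse bs)) ≡ length (typeRep bs)
length-typeRep-reverse bs = begin
  length (typeRep (reverse bs))  ≡⟨ length-typeRep (reverse bs) ⟩
  length (filter T? (reverse bs)) ≡⟨ ↭-length (filter-↭ T? (↭-reverse bs)) ⟩
  length (filter T? bs)           ≡⟨ length-typeRep bs ⟨
  length (typeRep bs)             ∎
  where open ≡-Reasoning

length-dropLast : ∀ xs → length (dropLast xs) ≡ length xs ∸ 1
length-dropLast []           = refl
length-dropLast (x ∷ [])     = refl
length-dropLast (x ∷ y ∷ xs) = cong suc (length-dropLast (y ∷ xs))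

nth1-++ : ∀ xs x ys → nth1 (xs ++ x ∷ ys) (suc (length xs)) ≡ just x
nth1-++ []       x ys = refl
nth1-++ (_ ∷ xs) x ys = nth1-++ xs x ys

pivot-of-odd : ∀ b → length (freeTypeRep b) % 2 ≡ 1 →
               pivot b ≡ nth1 (typeRep b) (length (typeRep b) / 2)
pivot-of-odd b is-odd with length (freeTypeRep b) % 2 | is-odd
... | _ | refl = refl

pivot-middle : ∀ b xs x ys → typeRep b ≡ xs ++ x ∷ ys → length ys ≡ suc (length xs) →
               pivot b ≡ just x
pivot-middle b xs x ys b≡ ∣ys∣ = begin
  pivot b                                       ≡⟨ pivot-of-odd b odd-length ⟩
  nth1 (typeRep b) (length (typeRep b) / 2)     ≡⟨ cong₂ nth1 b≡ half ⟩
  nth1 (xs ++ x ∷ ys) (suc a)                   ≡⟨ nth1-++ xs x ys ⟩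
  just x                                        ∎
  where
  open ≡-Reasoning
  open +-*-Solver
  a = length xs
  ∣typeRep∣ : length (typeRep b) ≡ suc (a + suc a)
  ∣typeRep∣ = begin
    length (typeRep b)     ≡⟨ cong length b≡ ⟩
    length (xs ++ x ∷ ys)  ≡⟨ length-++ xs ⟩
    a + suc (length ys)    ≡⟨ cong (λ n → a + suc n) ∣ys∣ ⟩
    a + suc (suc a)        ≡⟨ +-suc a (suc a) ⟩
    suc (a + suc a)        ∎
  odd-length : length (freeTypeRep b) % 2 ≡ 1
  odd-length = begin
    length (freeTypeRep b) % 2      ≡⟨ cong (_% 2) (length-dropLast (typeRep b)) ⟩
    (length (typeRep b) ∸ 1) % 2    ≡⟨ cong (λ n → (n ∸ 1) % 2) ∣typeRep∣ ⟩
    (a + suc a) % 2                 ≡⟨ cong (_% 2) (solve 1 (λ a → a :+ (con 1 :+ a) := con 1 :+ a :* con 2) refl a) ⟩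
    (1 + a * 2) % 2                 ≡⟨ [m+kn]%n≡m%n 1 a 2 ⟩
    1                               ∎
  half : length (typeRep b) / 2 ≡ suc a
  half = begin
    length (typeRep b) / 2  ≡⟨ cong (_/ 2) ∣typeRep∣ ⟩
    suc (a + suc a) / 2     ≡⟨ cong (_/ 2) (solve 1 (λ a → con 1 :+ (a :+ (con 1 :+ a)) := (con 1 :+ a) :* con 2) refl a) ⟩
    suc a * 2 / 2           ≡⟨ m*n/n≡m (suc a) 2 ⟩
    suc a                   ∎

pivot-mirrored-run : ∀ P t → pivot (P ++ true ∷ replicate t false ++ true ∷ reverse P) ≡ just (suc t)
pivot-mirrored-run P t = pivot-middle b (typeRep P) (suc t) (typeRep (true ∷ reverse P))
  (trans (typeRep-++-true P _) (cong (typeRep P ++_) (typeRep-run t (reverse P))))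
  (cong suc (length-typeRep-reverse P))
  where
  b = P ++ true ∷ replicate t false ++ true ∷ reverse P

-- Self twin games

odd : ℕ → ℕ
odd s = suc (s + s)

odd-< : ∀ {i j} → i < j → odd i < odd j
odd-< i<j = s≤s (+-mono-< i<j i<j)

binRep-selfTwin : ∀ d → binRep (d ++ reverse d) ≡ (true ∷ false ∷ d) ++ reverse (true ∷ false ∷ d)
binRep-selfTwin d = cong (λ z → true ∷ false ∷ z)
  (trans (++-assoc d (reverse d) _) (cong (d ++_) (sym (reverse-++ (true ∷ false ∷ []) d))))

pivot-selfTwin : ∀ d P s → true ∷ false ∷ d ≡ P ++ true ∷ replicate s false →
                 pivot (binRep (d ++ reverse d)) ≡ just (odd s)
pivot-selfTwin d P s A≡ = begin
  pivot (binRep (d ++ reverse d))                                ≡⟨ cong pivot (binRep-selfTwin d) ⟩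
  pivot ((true ∷ false ∷ d) ++ reverse (true ∷ false ∷ d))       ≡⟨ cong (λ A → pivot (A ++ reverse A)) A≡ ⟩
  pivot ((P ++ true ∷ R) ++ reverse (P ++ true ∷ R))             ≡⟨ cong pivot (mirror-trailing-run P true false s) ⟩
  pivot (P ++ true ∷ replicate (s + s) false ++ true ∷ reverse P) ≡⟨ pivot-mirrored-run P (s + s) ⟩
  just (odd s)                                                   ∎
  where
  open ≡-Reasoning
  R = replicate s false

pivotValues : ℕ → List ℕ
pivotValues k = odd (suc k) ∷ applyDownFrom odd k

selfTwin-pivot-∈ : ∀ d {x} → pivot (binRep (d ++ reverse d)) ≡ just x → x ∈ pivotValues (length d)
selfTwin-pivot-∈ d {x} piv with lastTrue d
... | all-false n = here (begin
  x                  ≡⟨ just-injective (trans (sym piv) (pivot-selfTwin _ [] (suc n) refl)) ⟩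
  odd (suc n)        ≡⟨ cong (odd ∘ suc) (length-replicate n) ⟨
  odd (suc (length (replicate n false))) ∎)
  where open ≡-Reasoning
... | ends-with P s = there (subst (_∈ applyDownFrom odd _) x≡ (∈-applyDownFrom⁺ odd s<∣d∣))
  where
  open ≤-Reasoning
  x≡ : odd s ≡ x
  x≡ = just-injective (trans (sym (pivot-selfTwin _ (true ∷ false ∷ P) s refl)) piv)
  s<∣d∣ : s < length (P ++ true ∷ replicate s false)
  s<∣d∣ = begin-strict
    s                                        <⟨ n<1+n s ⟩
    suc s                                    ≡⟨ cong suc (length-replicate s) ⟨
    length (true ∷ replicate s false)        ≤⟨ m≤n+m _ (length P) ⟩
    length P + length (true ∷ replicate s false) ≡⟨ length-++ P ⟨
    length (P ++ true ∷ replicate s false)   ∎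

pivotValues-realised : ∀ k {x} → x ∈ pivotValues k →
                       ∃[ d ] length d ≡ k × pivot (binRep (d ++ reverse d)) ≡ just x
pivotValues-realised k (here refl) =
  replicate k false , length-replicate k , pivot-selfTwin _ [] (suc k) refl
pivotValues-realised k (there x∈) with ∈-applyDownFrom⁻ odd x∈
... | s , s<k , refl = zeros ++ true ∷ replicate s false , ∣d∣ ,
                       pivot-selfTwin _ (true ∷ false ∷ zeros) s refl
  where
  open ≡-Reasoning
  zeros = replicate (k ∸ suc s) false
  ∣d∣ : length (zeros ++ true ∷ replicate s false) ≡ k
  ∣d∣ = begin
    length (zeros ++ true ∷ replicate s false)    ≡⟨ length-++ zeros ⟩
    length zeros + suc (length (replicate s false)) ≡⟨ cong₂ (λ i j → i + suc j) (length-replicate _) (length-replicate s) ⟩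
    k ∸ suc s + suc s                              ≡⟨ m∸n+n≡m s<k ⟩
    k                                              ∎

pivotValues-unique : ∀ k → Unique (pivotValues k)
pivotValues-unique k = All.tabulate top-fresh ∷ applyDownFrom⁺₁ odd k (λ j<i _ → >⇒≢ (odd-< j<i))
  where
  top-fresh : ∀ {x} → x ∈ applyDownFrom odd k → odd (suc k) ≢ x
  top-fresh x∈ with ∈-applyDownFrom⁻ odd x∈
  ... | s , s<k , refl = >⇒≢ (odd-< (m<n⇒m<1+n s<k))

sum-pivotValues : ∀ k → sum (pivotValues k) ≡ 2 + (k + 1) ^ 2
sum-pivotValues k = trans (cong (odd (suc k) +_) (sum-odds k))
  (solve 1 (λ k → con 1 :+ ((con 1 :+ k) :+ (con 1 :+ k)) :+ k :* k := con 2 :+ (k :+ con 1) :^ 2) refl k)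
  where
  open +-*-Solver
  sum-odds : ∀ k → sum (applyDownFrom odd k) ≡ k * k
  sum-odds zero    = refl
  sum-odds (suc k) = trans (cong (odd k +_) (sum-odds k))
    (solve 1 (λ k → con 1 :+ (k :+ k) :+ k :* k := (con 1 :+ k) :* (con 1 :+ k)) refl k)

extensions : List Bool → List (List Bool)
extensions c = (false ∷ c) ∷ (true ∷ c) ∷ []

∈-allBoolLists⁺ : ∀ c → c ∈ allBoolLists (length c)
∈-allBoolLists⁺ []      = here refl
∈-allBoolLists⁺ (b ∷ c) = ∈-concat⁺′ (extension b) (∈-map⁺ extensions (∈-allBoolLists⁺ c))
  where
  extension : ∀ b → (b ∷ c) ∈ extensions c
  extension false = here refl
  extension true  = there (here refl)

∈-allBoolLists⁻ : ∀ m {c} → c ∈ allBoolLists m → length c ≡ m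
∈-allBoolLists⁻ zero    (here refl) = refl
∈-allBoolLists⁻ (suc m) c∈ with ∈-concat⁻′ (map extensions (allBoolLists m)) c∈
... | cs , c∈cs , cs∈ with ∈-map⁻ extensions cs∈
... | c′ , c′∈ , refl with c∈cs
...   | here refl         = cong suc (∈-allBoolLists⁻ m c′∈)
...   | there (here refl) = cong suc (∈-allBoolLists⁻ m c′∈)

∈-selfTwinGames⁺ : ∀ d → (d ++ reverse d) ∈ selfTwinGames (length d + length d)
∈-selfTwinGames⁺ d = ∈-filter⁺ selfTwin? c∈all c-pal
  where
  ∣c∣ : length (d ++ reverse d) ≡ length d + length d
  ∣c∣ = trans (length-++ d) (cong (length d +_) (length-reverse d))
  c∈all : d ++ reverse d ∈ allBoolLists (length d + length d)
  c∈all = subst (λ n → d ++ reverse d ∈ allBoolLists n) ∣c∣ (∈-allBoolLists⁺ (d ++ reverse d))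
  c-pal : SelfTwin (d ++ reverse d)
  c-pal = trans (reverse-++ d (reverse d)) (cong (_++ reverse d) (reverse-involutive d))

∈-selfTwinGames⁻ : ∀ k {c} → c ∈ selfTwinGames (k + k) → ∃[ d ] length d ≡ k × c ≡ d ++ reverse d
∈-selfTwinGames⁻ k {c} c∈ with ∈-filter⁻ selfTwin? {xs = allBoolLists (k + k)} c∈
... | c∈all , c-pal = palindrome-halves k c (∈-allBoolLists⁻ (k + k) c∈all) c-pal

selfTwinPivots : ℕ → List ℕ
selfTwinPivots m = mapMaybe (λ c → pivot (binRep c)) (selfTwinGames m)

selfTwinPivots-∈⇔ : ∀ k {x} → x ∈ selfTwinPivots (k + k) ⇔ x ∈ pivotValues k
selfTwinPivots-∈⇔ k = mk⇔ to from
  where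
  to : ∀ {x} → x ∈ selfTwinPivots (k + k) → x ∈ pivotValues k
  to x∈ with ∈-mapMaybe⁻ _ _ x∈
  ... | c , c∈ , piv with ∈-selfTwinGames⁻ k c∈
  ... | d , refl , refl = selfTwin-pivot-∈ d piv
  from : ∀ {x} → x ∈ pivotValues k → x ∈ selfTwinPivots (k + k)
  from x∈ with pivotValues-realised k x∈
  ... | d , refl , piv = ∈-mapMaybe⁺ _ (∈-selfTwinGames⁺ d) piv

mainTheorem12 : (m k : ℕ) → m ≡ 2 * k → Z m ≡ 2 + (k + 1) ^ 2
mainTheorem12 m k m≡2k = begin
  Z m                  ≡⟨ cong Z (trans m≡2k (cong (k +_) (+-identityʳ k))) ⟩
  Z (k + k)            ≡⟨ sum-deduplicate (pivotValues-unique k) (selfTwinPivots-∈⇔ k) ⟩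
  sum (pivotValues k)  ≡⟨ sum-pivotValues k ⟩
  2 + (k + 1) ^ 2      ∎
  where open ≡-Reasoning
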